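{- If $\Theta\vdash S$ is a minimal type for $\mathsf{F}_{<:}^{\top}$ and $\Theta\vdash^\top T$ is an $\mathsf{F}_{<:}^{\top}$-type, then the subtyping algorithm terminates on input $\Theta\vdash_A S<:T$.
   Context: System $\mathsf{F}_{<:}^{K\top}$ types: $T ::= \top \mid X \mid T\to T \mid \forall^{K}(X<:T).T \mid \forall^{\top}(X<:T).T$ (up to $\alpha$-conversion). Contexts $\Theta$ are finite sequences of $X<:T$ (and $x:T$) with the usual well-formedness judgment $\Theta\vdash T$. An $\mathsf{F}_{<:}^{\top}$-type is a type with no $\forall^K$; $\Theta\vdash^\top T$ means $\Theta\vdash T$ where $T$ and all types in $\Theta$ are $\mathsf{F}_{<:}^{\top}$-types. The minimal types for $\mathsf{F}_{<:}^{\top}$ are the types generated by $T ::= S\mid\forall^K(X<:S).T\mid S\to T$, where $S$ ranges over $\mathsf{F}_{<:}^{\top}$-types. Algorithmic subtyping $\Theta\vdash_A S<:T$ is generated by: $\Theta\vdash_A T<:\top$; $\Theta\vdash_A X<:X$; if $\Theta=\Theta_1,X<:S,\Theta_2$ and $\Theta\vdash_A S<:T$ with $T\not\equiv\top$, $T\not\equiv X$, then $\Theta\vdash_A X<:T$; from $\Theta\vdash_A S'<:S$, $\Theta\vdash_A T<:T'$ infer $\Theta\vdash_A S\to T<:S'\to T'$; from $\Theta,X<:S\vdash_A T<:T'$ infer $\Theta\vdash_A\forall^K(X<:S).T<:\forall^K(X<:S).T'$; from $\Theta\vdash_A T_0<:S_0$, $\Theta,X<:S_0\vdash_A S_1<:T_1$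 infer $\Theta\vdash_A\forall^K(X<:S_0).S_1<:\forall^\top(X<:T_0).T_1$; from $\Theta\vdash_A T_0<:S_0$, $\Theta,X<:\top\vdash_A S_1<:T_1$ infer $\Theta\vdash_A\forall^\top(X<:S_0).S_1<:\forall^\top(X<:T_0).T_1$. The subtyping algorithm on input $\Theta\vdash_A S<:T$ performs deterministic bottom-up proof search: at most one rule has a matching conclusion; it recursively processes that rule's premises, accepting if all are accepted and rejecting if no rule applies or a premise is rejected. -}

module Defs where

open import Data.Nat using (ℕ; zero; suc; _<_; _<ᵇ_; _≡ᵇ_)
open import Data.Bool using (Bool; true; false; if_then_else_; _∧_)
open import Data.Maybe using (Maybe; just; nothing)
open import Data.List using (List; []; _∷_)
open import Data.List.Relation.Unary.All using (All)
open import Data.Product using (_×_; _,_)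
open import Relation.Binary.PropositionalEquality using (_≡_)

-- Types of System F<:^{K⊤}, in de Bruijn notation (so α-equivalent types
-- are syntactically equal).  In  allK B T  /  allT B T  the bound B is in
-- the outer scope and the body T binds the new variable as index 0.

data Ty : Set where
  top  : Ty
  var  : ℕ → Ty
  _⇒_  : Ty → Ty → Ty
  allK : Ty → Ty → Ty
  allT : Ty → Ty → Ty

infixr 7 _⇒_

eqTy : Ty → Ty → Bool
eqTy top top = true
eqTy (var i) (var j) = i ≡ᵇ j
eqTy (a ⇒ b) (c ⇒ d) = eqTy a c ∧ eqTy b d
eqTy (allK a b) (allK c d) = eqTy a c ∧ eqTy b d
eqTy (allT a b) (allT c d) = eqTy a c ∧ eqTy b d
eqTy _ _ = false

shiftFrom : ℕ → Ty → Ty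
shiftFrom c top = top
shiftFrom c (var i) = if i <ᵇ c then var i else var (suc i)
shiftFrom c (a ⇒ b) = shiftFrom c a ⇒ shiftFrom c b
shiftFrom c (allK a b) = allK (shiftFrom c a) (shiftFrom (suc c) b)
shiftFrom c (allT a b) = allT (shiftFrom c a) (shiftFrom (suc c) b)

shift : Ty → Ty
shift = shiftFrom 0

-- Contexts: finite sequences (rightmost = most recent) of type-variable
-- bindings X <: T and term-variable bindings x : T.  Type-variable
-- de Bruijn indices count only the type-variable bindings.

data Ctx : Set where
  ∅     : Ctx
  _,<:_ : Ctx → Ty → Ctx
  _,∶_  : Ctx → Ty → Ctx

infixl 5 _,<:_ _,∶_

ntv : Ctx → ℕ
ntv ∅ = 0
ntv (Θ ,<: _) = suc (ntv Θ)
ntv (Θ ,∶ _) = ntv Θ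

-- the bound of type variable i, weakened to the whole context
bound : Ctx → ℕ → Maybe Ty
bound ∅ i = nothing
bound (Θ ,∶ _) i = bound Θ i
bound (Θ ,<: B) zero = just (shift B)
bound (Θ ,<: B) (suc i) with bound Θ i
... | just C = just (shift C)
... | nothing = nothing

data WfTy (n : ℕ) : Ty → Set where
  wf-top  : WfTy n top
  wf-var  : ∀ {i} → i < n → WfTy n (var i)
  wf-⇒    : ∀ {a b} → WfTy n a → WfTy n b → WfTy n (a ⇒ b)
  wf-allK : ∀ {a b} → WfTy n a → WfTy (suc n) b → WfTy n (allK a b)
  wf-allT : ∀ {a b} → WfTy n a → WfTy (suc n) b → WfTy n (allT a b)

data WfCtx : Ctx → Set where
  wf-∅  : WfCtx ∅
  wf-<: : ∀ {Θ T} → WfCtx Θ → WfTy (ntv Θ) T → WfCtx (Θ ,<: T)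
  wf-∶  : ∀ {Θ T} → WfCtx Θ → WfTy (ntv Θ) T → WfCtx (Θ ,∶ T)

_⊢_ : Ctx → Ty → Set
Θ ⊢ T = WfCtx Θ × WfTy (ntv Θ) T

data TopTy : Ty → Set where
  tt-top  : TopTy top
  tt-var  : ∀ {i} → TopTy (var i)
  tt-⇒    : ∀ {a b} → TopTy a → TopTy b → TopTy (a ⇒ b)
  tt-allT : ∀ {a b} → TopTy a → TopTy b → TopTy (allT a b)

data TopCtx : Ctx → Set where
  tc-∅  : TopCtx ∅
  tc-<: : ∀ {Θ T} → TopCtx Θ → TopTy T → TopCtx (Θ ,<: T)
  tc-∶  : ∀ {Θ T} → TopCtx Θ → TopTy T → TopCtx (Θ ,∶ T)

_⊢⊤_ : Ctx → Ty → Set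
Θ ⊢⊤ T = (Θ ⊢ T) × TopCtx Θ × TopTy T

data Minimal : Ty → Set where
  min-base : ∀ {S} → TopTy S → Minimal S
  min-allK : ∀ {S T} → TopTy S → Minimal T → Minimal (allK S T)
  min-⇒    : ∀ {S T} → TopTy S → Minimal T → Minimal (S ⇒ T)

-- The subtyping algorithm: one step of deterministic bottom-up proof
-- search.  Given a goal Θ ⊢_A S <: T, 'step' finds the unique rule whose
-- conclusion matches (if any) and returns its premises in order.

Goal : Set
Goal = Ctx × Ty × Ty

data Outcome : Set where
  accept  : Outcome
  reject  : Outcome
  premises : List Goal → Outcome

viaBound : Ctx → ℕ → Ty → Outcome
viaBound Θ i T with bound Θ i
... | just B  = premises ((Θ , B , T) ∷ [])
... | nothing = reject

step : Ctx → Ty → Ty → Outcome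
step Θ S top = accept
step Θ (var i) (var j) = if i ≡ᵇ j then accept else viaBound Θ i (var j)
step Θ (var i) (a ⇒ b) = viaBound Θ i (a ⇒ b)
step Θ (var i) (allK a b) = viaBound Θ i (allK a b)
step Θ (var i) (allT a b) = viaBound Θ i (allT a b)
step Θ (S ⇒ T) (S' ⇒ T') = premises ((Θ , S' , S) ∷ (Θ , T , T') ∷ [])
step Θ (allK S T) (allK S' T') =
  if eqTy S S' then premises ((Θ ,<: S , T , T') ∷ []) else reject
step Θ (allK S₀ S₁) (allT T₀ T₁) =
  premises ((Θ , T₀ , S₀) ∷ (Θ ,<: S₀ , S₁ , T₁) ∷ [])
step Θ (allT S₀ S₁) (allT T₀ T₁) =
  premises ((Θ , T₀ , S₀) ∷ (Θ ,<: top , S₁ , T₁) ∷ [])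
step Θ _ _ = reject

-- Termination of the algorithm on an input: the search tree is finite,
-- i.e. either the step finishes immediately (accept/reject), or a rule
-- applies and the algorithm terminates on every one of its premises.
-- (Inductive, hence well-founded: exactly "the recursive run is finite".)

data Terminates : Ctx → Ty → Ty → Set where
  term-accept : ∀ {Θ S T} → step Θ S T ≡ accept → Terminates Θ S T
  term-reject : ∀ {Θ S T} → step Θ S T ≡ reject → Terminates Θ S T
  term-rule   : ∀ {Θ S T gs} → step Θ S T ≡ premises gs →
                All (λ { (Θ' , S' , T') → Terminates Θ' S' T' }) gs →
                Terminates Θ S T

module Submission where

-- Give each type variable the weight 1 + (size of its bound) and measure a
-- type by its size with variables counted at their weights.  Promoting a
-- variable to its bound then strictly decreases the measure, and so do the
-- arrow and ∀^⊤ rules, because ∀^⊤ bodies are compared under the bound ⊤,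
-- whose weight is a constant independent of the bounds being compared.  On
-- F<:^⊤-types the algorithm therefore terminates by induction on the sum of
-- the sizes of the two sides.  The only rule that extends the context with a
-- non-trivial bound is ∀^K <: ∀^⊤; for a minimal left-hand side it is applied
-- only along the ∀^K/→ spine, which is handled by structural induction on
-- the minimality derivation, its other premises being F<:^⊤-problems.

open import Defs
open import Data.Nat
open import Data.Nat.Properties
open import Data.Bool using (true; false; if_then_else_)
open import Data.Maybe using (just; nothing)
open import Data.List using ([]; _∷_)
open import Data.List.Relation.Unary.All using ([]; _∷_)
open import Data.Product using (_,_)
open import Relation.Binary.PropositionalEquality

Weights : Set
Weights = ℕ → ℕ

_∷ʷ_ : ℕ → Weights → Weights
(x ∷ʷ ρ) zero = x
(x ∷ʷ ρ) (suc j) = ρ j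

-- A bound variable counts as 2 = 1 + size top, whatever its bound.
size : Weights → Ty → ℕ
size ρ top = 1
size ρ (var i) = ρ i
size ρ (a ⇒ b) = suc (size ρ a + size ρ b)
size ρ (allK a b) = suc (size ρ a + size (2 ∷ʷ ρ) b)
size ρ (allT a b) = suc (size ρ a + size (2 ∷ʷ ρ) b)

insertAt : ℕ → ℕ → Weights → Weights
insertAt zero x ρ = x ∷ʷ ρ
insertAt (suc c) x ρ = ρ 0 ∷ʷ insertAt c x (λ j → ρ (suc j))

insertAt-shiftedIndex : ∀ c x ρ i →
  insertAt c x ρ (if i <ᵇ c then i else suc i) ≡ ρ i
insertAt-shiftedIndex zero x ρ i = refl
insertAt-shiftedIndex (suc c) x ρ zero = refl
insertAt-shiftedIndex (suc c) x ρ (suc i)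
  with i <ᵇ c | insertAt-shiftedIndex c x (λ j → ρ (suc j)) i
... | true  | e = e
... | false | e = e

size-shiftFrom : ∀ c x ρ B → size (insertAt c x ρ) (shiftFrom c B) ≡ size ρ B
size-shiftFrom c x ρ top = refl
size-shiftFrom c x ρ (var i) with i <ᵇ c | insertAt-shiftedIndex c x ρ i
... | true  | e = e
... | false | e = e
size-shiftFrom c x ρ (a ⇒ b) =
  cong suc (cong₂ _+_ (size-shiftFrom c x ρ a) (size-shiftFrom c x ρ b))
size-shiftFrom c x ρ (allK a b) =
  cong suc (cong₂ _+_ (size-shiftFrom c x ρ a) (size-shiftFrom (suc c) x (2 ∷ʷ ρ) b))
size-shiftFrom c x ρ (allT a b) =
  cong suc (cong₂ _+_ (size-shiftFrom c x ρ a) (size-shiftFrom (suc c) x (2 ∷ʷ ρ) b))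

size-shift : ∀ x ρ B → size (x ∷ʷ ρ) (shift B) ≡ size ρ B
size-shift = size-shiftFrom 0

ctxWeights : Ctx → Weights
ctxWeights ∅ = λ _ → 1
ctxWeights (Θ ,<: B) = suc (size (ctxWeights Θ) B) ∷ʷ ctxWeights Θ
ctxWeights (Θ ,∶ _) = ctxWeights Θ

size-bound< : ∀ Θ i {B} → bound Θ i ≡ just B → size (ctxWeights Θ) B < ctxWeights Θ i
size-bound< ∅ i ()
size-bound< (Θ ,∶ _) i e = size-bound< Θ i e
size-bound< (Θ ,<: C) zero refl =
  subst (_< suc (size (ctxWeights Θ) C))
        (sym (size-shift (suc (size (ctxWeights Θ) C)) (ctxWeights Θ) C)) (n<1+n _)
size-bound< (Θ ,<: C) (suc i) e with bound Θ i in eΘ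
size-bound< (Θ ,<: C) (suc i) refl | just D =
  subst (_< ctxWeights Θ i)
        (sym (size-shift (suc (size (ctxWeights Θ) C)) (ctxWeights Θ) D)) (size-bound< Θ i eΘ)

TopTy-shiftFrom : ∀ c {B} → TopTy B → TopTy (shiftFrom c B)
TopTy-shiftFrom c tt-top = tt-top
TopTy-shiftFrom c (tt-var {i}) with i <ᵇ c
... | true  = tt-var
... | false = tt-var
TopTy-shiftFrom c (tt-⇒ a b) = tt-⇒ (TopTy-shiftFrom c a) (TopTy-shiftFrom c b)
TopTy-shiftFrom c (tt-allT a b) = tt-allT (TopTy-shiftFrom c a) (TopTy-shiftFrom (suc c) b)

TopTy-bound : ∀ {Θ} i {B} → TopCtx Θ → bound Θ i ≡ just B → TopTy B
TopTy-bound i tc-∅ ()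
TopTy-bound i (tc-∶ tΘ _) e = TopTy-bound i tΘ e
TopTy-bound zero (tc-<: tΘ t) refl = TopTy-shiftFrom 0 t
TopTy-bound {Θ ,<: C} (suc i) (tc-<: tΘ t) e with bound Θ i in eΘ
TopTy-bound {Θ ,<: C} (suc i) (tc-<: tΘ t) refl | just D =
  TopTy-shiftFrom 0 (TopTy-bound i tΘ eΘ)

-- The measure decreases from S ⇒ T <: S' ⇒ T' to each premise; the same
-- arithmetic serves the ∀^⊤ rule.
c+a<[1+a+b]+[1+c+d] : ∀ a b c d → c + a < suc (a + b) + suc (c + d)
c+a<[1+a+b]+[1+c+d] a b c d = s≤s (begin
  c + a                 ≡⟨ +-comm c a ⟩
  a + c                 ≤⟨ +-mono-≤ (m≤m+n a b) (m≤m+n c d) ⟩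
  a + b + (c + d)       ≤⟨ +-monoʳ-≤ (a + b) (n≤1+n (c + d)) ⟩
  a + b + suc (c + d)   ∎)
  where open ≤-Reasoning

b+d<[1+a+b]+[1+c+d] : ∀ a b c d → b + d < suc (a + b) + suc (c + d)
b+d<[1+a+b]+[1+c+d] a b c d = s≤s (begin
  b + d                 ≤⟨ +-mono-≤ (m≤n+m b a) (m≤n+m d c) ⟩
  a + b + (c + d)       ≤⟨ +-monoʳ-≤ (a + b) (n≤1+n (c + d)) ⟩
  a + b + suc (c + d)   ∎)
  where open ≤-Reasoning

measure : Ctx → Ty → Ty → ℕ
measure Θ S T = size (ctxWeights Θ) S + size (ctxWeights Θ) T

mutual
  -- n is fuel: an upper bound on the measure of the input.
  terminates-top-bounded : ∀ n Θ S T → TopCtx Θ → TopTy S → TopTy T →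
    measure Θ S T < n → Terminates Θ S T
  terminates-top-bounded (suc n) Θ S top _ _ _ _ = term-accept refl
  terminates-top-bounded (suc n) Θ (var i) (var j) tΘ _ tT m<n with i ≡ᵇ j in i≡ᵇj
  ... | true  = term-accept (cong (λ b → if b then accept else viaBound Θ i (var j)) i≡ᵇj)
  ... | false = terminates-via-bound n Θ i (var j) tΘ tT m<n
                  (cong (λ b → if b then accept else viaBound Θ i (var j)) i≡ᵇj)
  terminates-top-bounded (suc n) Θ (var i) (_ ⇒ _) tΘ _ tT m<n =
    terminates-via-bound n Θ i _ tΘ tT m<n refl
  terminates-top-bounded (suc n) Θ (var i) (allT _ _) tΘ _ tT m<n =
    terminates-via-bound n Θ i _ tΘ tT m<n refl
  terminates-top-bounded (suc n) Θ (a ⇒ b) (c ⇒ d) tΘ (tt-⇒ ta tb) (tt-⇒ tc td) m<n =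
    term-rule refl
      ( terminates-top-bounded n Θ c a tΘ tc ta
          (<-≤-trans (c+a<[1+a+b]+[1+c+d] (sz a) (sz b) (sz c) (sz d)) (≤-pred m<n))
      ∷ terminates-top-bounded n Θ b d tΘ tb td
          (<-≤-trans (b+d<[1+a+b]+[1+c+d] (sz a) (sz b) (sz c) (sz d)) (≤-pred m<n))
      ∷ [])
    where sz = size (ctxWeights Θ)
  terminates-top-bounded (suc n) Θ (allT a b) (allT c d) tΘ (tt-allT ta tb) (tt-allT tc td) m<n =
    term-rule refl
      ( terminates-top-bounded n Θ c a tΘ tc ta
          (<-≤-trans (c+a<[1+a+b]+[1+c+d] (sz a) (sz' b) (sz c) (sz' d)) (≤-pred m<n))
      ∷ terminates-top-bounded n (Θ ,<: top) b d (tc-<: tΘ tt-top) tb td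
          (<-≤-trans (b+d<[1+a+b]+[1+c+d] (sz a) (sz' b) (sz c) (sz' d)) (≤-pred m<n))
      ∷ [])
    where sz  = size (ctxWeights Θ)
          sz' = size (ctxWeights (Θ ,<: top))
  terminates-top-bounded (suc n) Θ top (var _) _ _ _ _ = term-reject refl
  terminates-top-bounded (suc n) Θ top (_ ⇒ _) _ _ _ _ = term-reject refl
  terminates-top-bounded (suc n) Θ top (allT _ _) _ _ _ _ = term-reject refl
  terminates-top-bounded (suc n) Θ (_ ⇒ _) (var _) _ _ _ _ = term-reject refl
  terminates-top-bounded (suc n) Θ (_ ⇒ _) (allT _ _) _ _ _ _ = term-reject refl
  terminates-top-bounded (suc n) Θ (allT _ _) (var _) _ _ _ _ = term-reject refl
  terminates-top-bounded (suc n) Θ (allT _ _) (_ ⇒ _) _ _ _ _ = term-reject refl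

  terminates-via-bound : ∀ n Θ i T → TopCtx Θ → TopTy T →
    ctxWeights Θ i + size (ctxWeights Θ) T < suc n →
    step Θ (var i) T ≡ viaBound Θ i T → Terminates Θ (var i) T
  terminates-via-bound n Θ i T tΘ tT m<n st with bound Θ i in eB
  ... | nothing = term-reject st
  ... | just B  = term-rule st
    ( terminates-top-bounded n Θ B T tΘ (TopTy-bound i tΘ eB) tT
        (<-≤-trans (+-monoˡ-< (size (ctxWeights Θ) T) (size-bound< Θ i eB)) (≤-pred m<n))
    ∷ [])

terminates-top : ∀ Θ S T → TopCtx Θ → TopTy S → TopTy T → Terminates Θ S T
terminates-top Θ S T tΘ tS tT = terminates-top-bounded _ Θ S T tΘ tS tT (n<1+n _)

terminates-minimal : ∀ Θ S T → TopCtx Θ → Minimal S → TopTy T → Terminates Θ S T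
terminates-minimal Θ S T tΘ (min-base tS) tT = terminates-top Θ S T tΘ tS tT
terminates-minimal Θ _ top _ (min-allK _ _) _ = term-accept refl
terminates-minimal Θ _ (var _) _ (min-allK _ _) _ = term-reject refl
terminates-minimal Θ _ (_ ⇒ _) _ (min-allK _ _) _ = term-reject refl
terminates-minimal Θ (allK S₀ S₁) (allT T₀ T₁) tΘ (min-allK tS₀ mS₁) (tt-allT tT₀ tT₁) =
  term-rule refl
    ( terminates-top Θ T₀ S₀ tΘ tT₀ tS₀
    ∷ terminates-minimal (Θ ,<: S₀) S₁ T₁ (tc-<: tΘ tS₀) mS₁ tT₁
    ∷ [])
terminates-minimal Θ _ top _ (min-⇒ _ _) _ = term-accept refl
terminates-minimal Θ _ (var _) _ (min-⇒ _ _) _ = term-reject refl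
terminates-minimal Θ _ (allT _ _) _ (min-⇒ _ _) _ = term-reject refl
terminates-minimal Θ (S₀ ⇒ S₁) (T₀ ⇒ T₁) tΘ (min-⇒ tS₀ mS₁) (tt-⇒ tT₀ tT₁) =
  term-rule refl
    ( terminates-top Θ T₀ S₀ tΘ tT₀ tS₀
    ∷ terminates-minimal Θ S₁ T₁ tΘ mS₁ tT₁
    ∷ [])

mainTheorem10 : ∀ (Θ : Ctx) (S T : Ty) →
    Θ ⊢ S → Minimal S → Θ ⊢⊤ T → Terminates Θ S T
mainTheorem10 Θ S T _ minS (_ , topΘ , topT) = terminates-minimal Θ S T topΘ minS topT
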